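{- Fix $k\in\mathbb Z_{\ge0}$. The map $\Phi(X,Y,Z)=(-(YZ)^{ -1},-(XZ)^{ -1},-(XY)^{ -1})$ restricts to a bijection from the set of $k$-MM triples onto the set of $k$-GC triples.
   Context: Fix $k\in\mathbb Z_{\ge0}$. A $k$-GM triple is $(a,b,c)\in\mathbb Z_{\ge1}^3$ with $a^2+b^2+c^2+k(bc+ca+ab)=(3+3k)abc$; a $k$-GM number is an entry of some $k$-GM triple. Let $S=\begin{bmatrix}k&0\\3k^2+3k&k\end{bmatrix}$, $T=\begin{bmatrix}-1&0\\3k+3&-1\end{bmatrix}$. A $k$-GC matrix is $P\in SL(2,\mathbb Z)$ whose $(1,2)$-entry $p_{12}$ is a $k$-GM number and $\operatorname{tr}P=(3k+3)p_{12}-k$; a $k$-GC triple is a triple $(P,Q,R)$ of $k$-GC matrices with $Q=PR-S$ and $(p_{12},q_{12},r_{12})$ a $k$-GM triple. A $k$-MM matrix is $X\in SL(2,\mathbb Z)$ whose $(1,2)$-entry is a $k$-GM number and $\operatorname{tr}X=-k$; a $k$-MM triple is a triple $(X,Y,Z)$ of $k$-MM matrices with $XYZ=T$ whose $(1,2)$-entries form a $k$-GM triple. $\Phi$ is defined on triples of invertible $2\times 2$ matrices. -}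

module Defs where

open import Data.Nat using (ℕ)
open import Data.Integer using (ℤ; +_; _+_; _*_; -_; _-_; _<_; 0ℤ; 1ℤ)
open import Data.Product using (Σ; ∃; ∃-syntax; _×_; _,_)
open import Data.Sum using (_⊎_)
open import Relation.Binary.PropositionalEquality using (_≡_)

record Mat : Set where
  constructor mat
  field
    a11 a12 a21 a22 : ℤ
open Mat public

_⊗_ : Mat → Mat → Mat
mat a b c d ⊗ mat e f g h = mat (a * e + b * g) (a * f + b * h) (c * e + d * g) (c * f + d * h)
infixl 7 _⊗_

_⊖_ : Mat → Mat → Mat
mat a b c d ⊖ mat e f g h = mat (a - e) (b - f) (c - g) (d - h)
infixl 6 _⊖_

neg : Mat → Mat
neg (mat a b c d) = mat (- a) (- b) (- c) (- d)

det : Mat → ℤ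
det (mat a b c d) = a * d - b * c

tr : Mat → ℤ
tr (mat a b c d) = a + d

-- Inverse of an invertible integer 2×2 matrix (det = ±1, so 1/det = det):
-- inv M = det M · adj M.
inv : Mat → Mat
inv M@(mat a b c d) = mat (det M * d) (det M * (- b)) (det M * (- c)) (det M * a)

InSL2 : Mat → Set
InSL2 M = det M ≡ 1ℤ

Triple : Set → Set
Triple A = A × A × A

GMTriple : ℕ → ℤ → ℤ → ℤ → Set
GMTriple k a b c =
  (0ℤ < a) × (0ℤ < b) × (0ℤ < c) ×
  (a * a + b * b + c * c + (+ k) * (b * c + c * a + a * b)
     ≡ (+ 3 + + 3 * + k) * a * b * c)

GMNumber : ℕ → ℤ → Set
GMNumber k n = ∃[ b ] ∃[ c ] (GMTriple k n b c ⊎ GMTriple k b n c ⊎ GMTriple k b c n)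

Smat : ℕ → Mat
Smat k = mat (+ k) 0ℤ (+ 3 * + k * + k + + 3 * + k) (+ k)

Tmat : ℕ → Mat
Tmat k = mat (- 1ℤ) 0ℤ (+ 3 * + k + + 3) (- 1ℤ)

GCMatrix : ℕ → Mat → Set
GCMatrix k P = InSL2 P × GMNumber k (a12 P) × (tr P ≡ (+ 3 * + k + + 3) * a12 P - + k)

GCTriple : ℕ → Triple Mat → Set
GCTriple k (P , Q , R) =
  GCMatrix k P × GCMatrix k Q × GCMatrix k R ×
  (Q ≡ P ⊗ R ⊖ Smat k) × GMTriple k (a12 P) (a12 Q) (a12 R)

MMMatrix : ℕ → Mat → Set
MMMatrix k X = InSL2 X × GMNumber k (a12 X) × (tr X ≡ - (+ k))

MMTriple : ℕ → Triple Mat → Set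
MMTriple k (X , Y , Z) =
  MMMatrix k X × MMMatrix k Y × MMMatrix k Z ×
  (X ⊗ Y ⊗ Z ≡ Tmat k) × GMTriple k (a12 X) (a12 Y) (a12 Z)

Φ : Triple Mat → Triple Mat
Φ (X , Y , Z) = neg (inv (Y ⊗ Z)) , neg (inv (X ⊗ Z)) , neg (inv (X ⊗ Y))

{-# OPTIONS --safe #-}
-- For X, Z ∈ SL(2,ℤ) the relation XYZ = T forces Y = X⁻¹TZ⁻¹, and since
-- -T⁻¹ = L := [[1,0],[3k+3,1]] this gives Φ(X,Y,Z) = (LX, -(XZ)⁻¹, ZL).
-- Multiplying by L leaves the (1,2)-entry alone and adds 3k+3 times it to the
-- trace, so k-MM triples and k-GC triples are both described by the same
-- conditions on the outer pair (X, Z): tr X = tr Z = -k,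
-- tr(XZ) + (3k+3)(XZ)₁₂ = k (this is tr Y = -k, and also Q = PR - S), and
-- (x₁₂, (XZ)₁₂, z₁₂) is a k-GM triple.  The last condition is equivalent to
-- (x₁₂, y₁₂, z₁₂) being one, because y₁₂ + (XZ)₁₂ = (3k+3)x₁₂z₁₂ - k(x₁₂ + z₁₂)
-- makes (XZ)₁₂ the Vieta partner of y₁₂ in the k-GM equation.
module Submission where

open import Defs
open import Data.Integer using (ℤ; +_; +[1+_]; +0; -[1+_]; _+_; _*_; -_; _-_; _<_; _≤_; 0ℤ; 1ℤ; +<+; +≤+)
open import Data.Integer.Base using (nonNegative)
open import Data.Integer.Properties
  using ( neg-involutive; neg-injective; *-identityˡ; *-zeroʳ; +-identityʳ; i≡j⇒i-j≡0; i-j≡0⇒i≡j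
        ; *-cancelˡ-<-nonNeg; +-mono-<-≤; <⇒≤; pos-*)
open import Data.Integer.Tactic.RingSolver using (solve; solve-∀)
open import Data.List using (_∷_; [])
open import Data.Nat using (ℕ; suc; z≤n; s≤s)
import Data.Nat as ℕ
open import Data.Product using (∃-syntax; _×_; _,_; proj₁; proj₂)
open import Data.Sum using (inj₁; inj₂)
open import Function.Base using (_∘′_)
open import Function.Bundles using (_⇔_; mk⇔; module Equivalence)
open import Relation.Binary.PropositionalEquality
open ≡-Reasoning

mat-cong : ∀ {a b c d a′ b′ c′ d′ : ℤ} →
           a ≡ a′ → b ≡ b′ → c ≡ c′ → d ≡ d′ → mat a b c d ≡ mat a′ b′ c′ d′
mat-cong refl refl refl refl = refl

infixr 8 _⊙_
_⊙_ : ℤ → Mat → Mat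
δ ⊙ mat a b c d = mat (δ * a) (δ * b) (δ * c) (δ * d)

adj : Mat → Mat
adj (mat a b c d) = mat d (- b) (- c) a

1⊙A≡A : ∀ A → 1ℤ ⊙ A ≡ A
1⊙A≡A (mat a b c d) = mat-cong (*-identityˡ a) (*-identityˡ b) (*-identityˡ c) (*-identityˡ d)

-- The ring-solver macros do not normalise their goal, so each entry identity
-- is stated explicitly and proved by solve-∀.
⊗-assoc : ∀ A B C → A ⊗ B ⊗ C ≡ A ⊗ (B ⊗ C)
⊗-assoc (mat a b c d) (mat e f g h) (mat p q r s) =
  mat-cong (entry a b e f g h p r) (entry a b e f g h q s) (entry c d e f g h p r) (entry c d e f g h q s)
  where
  entry : ∀ x y e f g h u v → (x * e + y * g) * u + (x * f + y * h) * v ≡ x * (e * u + f * v) + y * (g * u + h * v)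
  entry = solve-∀

adj-⊗ : ∀ A B → adj (A ⊗ B) ≡ adj B ⊗ adj A
adj-⊗ (mat a b c d) (mat e f g h) = mat-cong (e₁ c d f h) (e₂ a b f h) (e₃ c d e g) (e₄ a b e g)
  where
  e₁ : ∀ c d f h → c * f + d * h ≡ h * d + - f * - c
  e₁ = solve-∀
  e₂ : ∀ a b f h → - (a * f + b * h) ≡ h * - b + - f * a
  e₂ = solve-∀
  e₃ : ∀ c d e g → - (c * e + d * g) ≡ - g * d + e * - c
  e₃ = solve-∀
  e₄ : ∀ a b e g → a * e + b * g ≡ - g * - b + e * a
  e₄ = solve-∀

adj-involutive : ∀ A → adj (adj A) ≡ A
adj-involutive (mat a b c d) = mat-cong refl (neg-involutive b) (neg-involutive c) refl

neg-⊗ˡ : ∀ A B → neg (A ⊗ B) ≡ neg A ⊗ B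
neg-⊗ˡ (mat a b c d) (mat e f g h) = mat-cong (entry a b e g) (entry a b f h) (entry c d e g) (entry c d f h)
  where
  entry : ∀ x y u v → - (x * u + y * v) ≡ - x * u + - y * v
  entry = solve-∀

neg-⊗ʳ : ∀ A B → neg (A ⊗ B) ≡ A ⊗ neg B
neg-⊗ʳ (mat a b c d) (mat e f g h) = mat-cong (entry a b e g) (entry a b f h) (entry c d e g) (entry c d f h)
  where
  entry : ∀ x y u v → - (x * u + y * v) ≡ x * - u + y * - v
  entry = solve-∀

det-⊗ : ∀ A B → det (A ⊗ B) ≡ det A * det B
det-⊗ (mat a b c d) (mat e f g h) = polynomial a b c d e f g h
  where
  polynomial : ∀ a b c d e f g h →
    (a * e + b * g) * (c * f + d * h) - (a * f + b * h) * (c * e + d * g) ≡ (a * d - b * c) * (e * h - f * g)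
  polynomial = solve-∀

det-adj : ∀ A → det (adj A) ≡ det A
det-adj (mat a b c d) = polynomial a b c d
  where
  polynomial : ∀ a b c d → d * a - - b * - c ≡ a * d - b * c
  polynomial = solve-∀

det-neg : ∀ A → det (neg A) ≡ det A
det-neg (mat a b c d) = polynomial a b c d
  where
  polynomial : ∀ a b c d → - a * - d - - b * - c ≡ a * d - b * c
  polynomial = solve-∀

tr-comm : ∀ A B → tr (A ⊗ B) ≡ tr (B ⊗ A)
tr-comm (mat a b c d) (mat e f g h) = polynomial a b c d e f g h
  where
  polynomial : ∀ a b c d e f g h → (a * e + b * g) + (c * f + d * h) ≡ (e * a + f * c) + (g * b + h * d)
  polynomial = solve-∀

tr-neg-adj : ∀ A → tr (neg (adj A)) ≡ - tr A
tr-neg-adj (mat a b c d) = polynomial a d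
  where
  polynomial : ∀ a d → - d + - a ≡ - (a + d)
  polynomial = solve-∀

a12-neg-adj : ∀ A → a12 (neg (adj A)) ≡ a12 A
a12-neg-adj A = neg-involutive (a12 A)

adjA⊗[A⊗B]≡detA⊙B : ∀ A B → adj A ⊗ (A ⊗ B) ≡ det A ⊙ B
adjA⊗[A⊗B]≡detA⊙B (mat a b c d) (mat e f g h) =
  mat-cong (row₁ a b c d e g) (row₁ a b c d f h) (row₂ a b c d e g) (row₂ a b c d f h)
  where
  row₁ : ∀ a b c d x y → d * (a * x + b * y) + - b * (c * x + d * y) ≡ (a * d - b * c) * x
  row₁ = solve-∀
  row₂ : ∀ a b c d x y → - c * (a * x + b * y) + a * (c * x + d * y) ≡ (a * d - b * c) * y
  row₂ = solve-∀

A⊗[adjA⊗B]≡detA⊙B : ∀ A B → A ⊗ (adj A ⊗ B) ≡ det A ⊙ B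
A⊗[adjA⊗B]≡detA⊙B (mat a b c d) (mat e f g h) =
  mat-cong (row₁ a b c d e g) (row₁ a b c d f h) (row₂ a b c d e g) (row₂ a b c d f h)
  where
  row₁ : ∀ a b c d x y → a * (d * x + - b * y) + b * (- c * x + a * y) ≡ (a * d - b * c) * x
  row₁ = solve-∀
  row₂ : ∀ a b c d x y → c * (d * x + - b * y) + d * (- c * x + a * y) ≡ (a * d - b * c) * y
  row₂ = solve-∀

B⊗A⊗adjA≡detA⊙B : ∀ A B → B ⊗ A ⊗ adj A ≡ det A ⊙ B
B⊗A⊗adjA≡detA⊙B (mat a b c d) (mat e f g h) =
  mat-cong (col₁ a b c d e f) (col₂ a b c d e f) (col₁ a b c d g h) (col₂ a b c d g h)
  where
  col₁ : ∀ a b c d x y → (x * a + y * c) * d + (x * b + y * d) * - c ≡ (a * d - b * c) * x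
  col₁ = solve-∀
  col₂ : ∀ a b c d x y → (x * a + y * c) * - b + (x * b + y * d) * a ≡ (a * d - b * c) * y
  col₂ = solve-∀

B⊗adjA⊗A≡detA⊙B : ∀ A B → B ⊗ adj A ⊗ A ≡ det A ⊙ B
B⊗adjA⊗A≡detA⊙B (mat a b c d) (mat e f g h) =
  mat-cong (col₁ a b c d e f) (col₂ a b c d e f) (col₁ a b c d g h) (col₂ a b c d g h)
  where
  col₁ : ∀ a b c d x y → (x * d + y * - c) * a + (x * - b + y * a) * c ≡ (a * d - b * c) * x
  col₁ = solve-∀
  col₂ : ∀ a b c d x y → (x * d + y * - c) * b + (x * - b + y * a) * d ≡ (a * d - b * c) * y
  col₂ = solve-∀

SL-⊗ : ∀ A B → InSL2 A → InSL2 B → InSL2 (A ⊗ B)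
SL-⊗ A B detA detB = trans (det-⊗ A B) (cong₂ _*_ detA detB)

SL-adj : ∀ A → InSL2 A → InSL2 (adj A)
SL-adj A detA = trans (det-adj A) detA

inv≡adj : ∀ A → InSL2 A → inv A ≡ adj A
inv≡adj (mat a b c d) detA =
  trans (cong (λ δ → mat (δ * d) (δ * - b) (δ * - c) (δ * a)) detA)
        (mat-cong (*-identityˡ d) (*-identityˡ (- b)) (*-identityˡ (- c)) (*-identityˡ a))

module _ (A : Mat) (detA : InSL2 A) where

  adjA⊗[A⊗B]≡B : ∀ B → adj A ⊗ (A ⊗ B) ≡ B
  adjA⊗[A⊗B]≡B B = trans (adjA⊗[A⊗B]≡detA⊙B A B) (trans (cong (_⊙ B) detA) (1⊙A≡A B))

  A⊗[adjA⊗B]≡B : ∀ B → A ⊗ (adj A ⊗ B) ≡ B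
  A⊗[adjA⊗B]≡B B = trans (A⊗[adjA⊗B]≡detA⊙B A B) (trans (cong (_⊙ B) detA) (1⊙A≡A B))

  B⊗A⊗adjA≡B : ∀ B → B ⊗ A ⊗ adj A ≡ B
  B⊗A⊗adjA≡B B = trans (B⊗A⊗adjA≡detA⊙B A B) (trans (cong (_⊙ B) detA) (1⊙A≡A B))

  B⊗adjA⊗A≡B : ∀ B → B ⊗ adj A ⊗ A ≡ B
  B⊗adjA⊗A≡B B = trans (B⊗adjA⊗A≡detA⊙B A B) (trans (cong (_⊙ B) detA) (1⊙A≡A B))

  SL-cancelˡ : ∀ {B B′} → A ⊗ B ≡ A ⊗ B′ → B ≡ B′
  SL-cancelˡ {B} {B′} eq = begin
    B                 ≡⟨ adjA⊗[A⊗B]≡B B ⟨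
    adj A ⊗ (A ⊗ B)   ≡⟨ cong (adj A ⊗_) eq ⟩
    adj A ⊗ (A ⊗ B′)  ≡⟨ adjA⊗[A⊗B]≡B B′ ⟩
    B′                ∎

  SL-cancelʳ : ∀ {B B′} → B ⊗ A ≡ B′ ⊗ A → B ≡ B′
  SL-cancelʳ {B} {B′} eq = begin
    B                 ≡⟨ B⊗A⊗adjA≡B B ⟨
    B ⊗ A ⊗ adj A     ≡⟨ cong (_⊗ adj A) eq ⟩
    B′ ⊗ A ⊗ adj A    ≡⟨ B⊗A⊗adjA≡B B′ ⟩
    B′                ∎

module _ (X Z : Mat) (detX : InSL2 X) (detZ : InSL2 Z) where

  middle-unique : ∀ {Y B} → X ⊗ Y ⊗ Z ≡ B → Y ≡ adj X ⊗ B ⊗ adj Z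
  middle-unique {Y} {B} XYZ≡B = begin
    Y                              ≡⟨ adjA⊗[A⊗B]≡B X detX Y ⟨
    adj X ⊗ (X ⊗ Y)                ≡⟨ B⊗A⊗adjA≡B Z detZ (adj X ⊗ (X ⊗ Y)) ⟨
    adj X ⊗ (X ⊗ Y) ⊗ Z ⊗ adj Z    ≡⟨ cong (_⊗ adj Z) (⊗-assoc (adj X) (X ⊗ Y) Z) ⟩
    adj X ⊗ (X ⊗ Y ⊗ Z) ⊗ adj Z    ≡⟨ cong (λ M → adj X ⊗ M ⊗ adj Z) XYZ≡B ⟩
    adj X ⊗ B ⊗ adj Z              ∎

  X⊗middle≡B⊗adjZ : ∀ B → X ⊗ (adj X ⊗ B ⊗ adj Z) ≡ B ⊗ adj Z
  X⊗middle≡B⊗adjZ B = begin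
    X ⊗ (adj X ⊗ B ⊗ adj Z)    ≡⟨ ⊗-assoc X (adj X ⊗ B) (adj Z) ⟨
    X ⊗ (adj X ⊗ B) ⊗ adj Z    ≡⟨ cong (_⊗ adj Z) (A⊗[adjA⊗B]≡B X detX B) ⟩
    B ⊗ adj Z                  ∎

  middle-spec : ∀ B → X ⊗ (adj X ⊗ B ⊗ adj Z) ⊗ Z ≡ B
  middle-spec B = begin
    X ⊗ (adj X ⊗ B ⊗ adj Z) ⊗ Z    ≡⟨ cong (_⊗ Z) (X⊗middle≡B⊗adjZ B) ⟩
    B ⊗ adj Z ⊗ Z                  ≡⟨ B⊗adjA⊗A≡B Z detZ B ⟩
    B                              ∎

-- Tmat k and Smat k are T (κ k) and S (+ k) definitionally.
κ : ℕ → ℤ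
κ k = + 3 * + k + + 3

L : ℤ → Mat
L c = mat 1ℤ 0ℤ c 1ℤ

T : ℤ → Mat
T c = mat (- 1ℤ) 0ℤ c (- 1ℤ)

S : ℤ → Mat
S K = mat K 0ℤ (+ 3 * K * K + + 3 * K) K

det-L : ∀ c → InSL2 (L c)
det-L c = refl

det-T : ∀ c → InSL2 (T c)
det-T c = refl

neg-adj-T : ∀ c → neg (adj (T c)) ≡ L c
neg-adj-T c = mat-cong refl refl (neg-involutive c) refl

neg-adj-L : ∀ c → neg (adj (L c)) ≡ T c
neg-adj-L c = mat-cong refl refl (neg-involutive c) refl

a12-L⊗ : ∀ c A → a12 (L c ⊗ A) ≡ a12 A
a12-L⊗ c (mat a b c′ d) = polynomial b d
  where
  polynomial : ∀ b d → 1ℤ * b + 0ℤ * d ≡ b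
  polynomial = solve-∀

a12-⊗L : ∀ c A → a12 (A ⊗ L c) ≡ a12 A
a12-⊗L c (mat a b c′ d) = polynomial a b
  where
  polynomial : ∀ a b → a * 0ℤ + b * 1ℤ ≡ b
  polynomial = solve-∀

tr-L⊗ : ∀ c A → tr (L c ⊗ A) ≡ tr A + c * a12 A
tr-L⊗ c (mat a b c′ d) = polynomial a b c′ d c
  where
  polynomial : ∀ a b c′ d c → (1ℤ * a + 0ℤ * c′) + (c * b + 1ℤ * d) ≡ (a + d) + c * b
  polynomial = solve-∀

tr-⊗L : ∀ c A → tr (A ⊗ L c) ≡ tr A + c * a12 A
tr-⊗L c (mat a b c′ d) = polynomial a b c′ d c
  where
  polynomial : ∀ a b c′ d c → (a * 1ℤ + b * c) + (c′ * 0ℤ + d * 1ℤ) ≡ (a + d) + c * b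
  polynomial = solve-∀

shifted-trace : ∀ c K t x → t ≡ - K ⇔ t + c * x ≡ c * x - K
shifted-trace c K t x = mk⇔
  (λ t≡-K → begin
    t + c * x      ≡⟨ cong (_+ c * x) t≡-K ⟩
    - K + c * x    ≡⟨ solve (c ∷ K ∷ x ∷ []) ⟩
    c * x - K      ∎)
  (λ eq → begin
    t                        ≡⟨ solve (c ∷ t ∷ x ∷ []) ⟩
    t + c * x - c * x        ≡⟨ cong (_- c * x) eq ⟩
    c * x - K - c * x        ≡⟨ solve (c ∷ K ∷ x ∷ []) ⟩
    - K                      ∎)

trace-L⊗ : ∀ c K A → tr A ≡ - K ⇔ tr (L c ⊗ A) ≡ c * a12 (L c ⊗ A) - K
trace-L⊗ c K A
  rewrite tr-L⊗ c A | a12-L⊗ c A = shifted-trace c K (tr A) (a12 A)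

trace-⊗L : ∀ c K A → tr A ≡ - K ⇔ tr (A ⊗ L c) ≡ c * a12 (A ⊗ L c) - K
trace-⊗L c K A
  rewrite tr-⊗L c A | a12-⊗L c A = shifted-trace c K (tr A) (a12 A)

neg-inv[adjA⊗T] : ∀ c A → InSL2 A → neg (inv (adj A ⊗ T c)) ≡ L c ⊗ A
neg-inv[adjA⊗T] c A detA = begin
  neg (inv (adj A ⊗ T c))
    ≡⟨ cong neg (inv≡adj (adj A ⊗ T c) (SL-⊗ (adj A) (T c) (SL-adj A detA) (det-T c))) ⟩
  neg (adj (adj A ⊗ T c))         ≡⟨ cong neg (adj-⊗ (adj A) (T c)) ⟩
  neg (adj (T c) ⊗ adj (adj A))   ≡⟨ cong (λ B → neg (adj (T c) ⊗ B)) (adj-involutive A) ⟩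
  neg (adj (T c) ⊗ A)             ≡⟨ neg-⊗ˡ (adj (T c)) A ⟩
  neg (adj (T c)) ⊗ A             ≡⟨ cong (_⊗ A) (neg-adj-T c) ⟩
  L c ⊗ A                         ∎

neg-inv[T⊗adjA] : ∀ c A → InSL2 A → neg (inv (T c ⊗ adj A)) ≡ A ⊗ L c
neg-inv[T⊗adjA] c A detA = begin
  neg (inv (T c ⊗ adj A))
    ≡⟨ cong neg (inv≡adj (T c ⊗ adj A) (SL-⊗ (T c) (adj A) (det-T c) (SL-adj A detA))) ⟩
  neg (adj (T c ⊗ adj A))         ≡⟨ cong neg (adj-⊗ (T c) (adj A)) ⟩
  neg (adj (adj A) ⊗ adj (T c))   ≡⟨ cong (λ B → neg (B ⊗ adj (T c))) (adj-involutive A) ⟩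
  neg (A ⊗ adj (T c))             ≡⟨ neg-⊗ʳ A (adj (T c)) ⟩
  A ⊗ neg (adj (T c))             ≡⟨ cong (A ⊗_) (neg-adj-T c) ⟩
  A ⊗ L c                         ∎

-- Y = X⁻¹ T Z⁻¹ = -(Z L X)⁻¹, which turns the entries of Y into those of ZLX.
middle≡neg-adj[Z⊗L⊗X] : ∀ c X Z → adj X ⊗ T c ⊗ adj Z ≡ neg (adj (Z ⊗ (L c ⊗ X)))
middle≡neg-adj[Z⊗L⊗X] c X Z = begin
  adj X ⊗ T c ⊗ adj Z                     ≡⟨ cong (λ B → adj X ⊗ B ⊗ adj Z) (neg-adj-L c) ⟨
  adj X ⊗ neg (adj (L c)) ⊗ adj Z         ≡⟨ cong (_⊗ adj Z) (neg-⊗ʳ (adj X) (adj (L c))) ⟨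
  neg (adj X ⊗ adj (L c)) ⊗ adj Z         ≡⟨ cong (λ B → neg B ⊗ adj Z) (adj-⊗ (L c) X) ⟨
  neg (adj (L c ⊗ X)) ⊗ adj Z             ≡⟨ neg-⊗ˡ (adj (L c ⊗ X)) (adj Z) ⟨
  neg (adj (L c ⊗ X) ⊗ adj Z)             ≡⟨ cong neg (adj-⊗ Z (L c ⊗ X)) ⟨
  neg (adj (Z ⊗ (L c ⊗ X)))               ∎

tr-middle : ∀ c X Z → tr (adj X ⊗ T c ⊗ adj Z) ≡ - (tr (X ⊗ Z) + c * a12 (X ⊗ Z))
tr-middle c X Z = begin
  tr (adj X ⊗ T c ⊗ adj Z)           ≡⟨ cong tr (middle≡neg-adj[Z⊗L⊗X] c X Z) ⟩
  tr (neg (adj (Z ⊗ (L c ⊗ X))))     ≡⟨ tr-neg-adj (Z ⊗ (L c ⊗ X)) ⟩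
  - tr (Z ⊗ (L c ⊗ X))               ≡⟨ cong -_ (tr-comm Z (L c ⊗ X)) ⟩
  - tr (L c ⊗ X ⊗ Z)                 ≡⟨ cong (λ B → - tr B) (⊗-assoc (L c) X Z) ⟩
  - tr (L c ⊗ (X ⊗ Z))               ≡⟨ cong -_ (tr-L⊗ c (X ⊗ Z)) ⟩
  - (tr (X ⊗ Z) + c * a12 (X ⊗ Z))   ∎

a12-Z⊗L⊗X : ∀ c X Z → a12 (Z ⊗ (L c ⊗ X)) + a12 (X ⊗ Z) ≡ c * a12 X * a12 Z + tr X * a12 Z + tr Z * a12 X
a12-Z⊗L⊗X c (mat a b c′ d) (mat e f g h) = polynomial a b d e f h c
  where
  polynomial : ∀ a b d e f h c →
    e * (1ℤ * b + 0ℤ * d) + f * (c * b + 1ℤ * d) + (a * f + b * h) ≡ c * b * f + (a + d) * f + (e + h) * b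
  polynomial = solve-∀

a12-middle : ∀ c X Z →
  a12 (adj X ⊗ T c ⊗ adj Z) + a12 (X ⊗ Z) ≡ c * a12 X * a12 Z + tr X * a12 Z + tr Z * a12 X
a12-middle c X Z = begin
  a12 (adj X ⊗ T c ⊗ adj Z) + a12 (X ⊗ Z)
    ≡⟨ cong (λ B → a12 B + a12 (X ⊗ Z)) (middle≡neg-adj[Z⊗L⊗X] c X Z) ⟩
  a12 (neg (adj (Z ⊗ (L c ⊗ X)))) + a12 (X ⊗ Z)
    ≡⟨ cong (_+ a12 (X ⊗ Z)) (a12-neg-adj (Z ⊗ (L c ⊗ X))) ⟩
  a12 (Z ⊗ (L c ⊗ X)) + a12 (X ⊗ Z)
    ≡⟨ a12-Z⊗L⊗X c X Z ⟩
  c * a12 X * a12 Z + tr X * a12 Z + tr Z * a12 X ∎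

-- The refl pattern solves for K, which turns each entry into a ring identity.
neg-adj≡L⊗M⊗L⊖[K,0,cK,K] : ∀ c K M → tr M + c * a12 M ≡ K →
                            neg (adj M) ≡ L c ⊗ M ⊗ L c ⊖ mat K 0ℤ (c * K) K
neg-adj≡L⊗M⊗L⊖[K,0,cK,K] c ._ (mat a b c′ d) refl =
  mat-cong (e₁₁ a b c′ d c) (e₁₂ a b c′ d) (e₂₁ a b c′ d c) (e₂₂ a b c′ d c)
  where
  e₁₁ : ∀ a b c′ d c → - d ≡ (1ℤ * a + 0ℤ * c′) * 1ℤ + (1ℤ * b + 0ℤ * d) * c - (a + d + c * b)
  e₁₁ = solve-∀
  e₁₂ : ∀ a b c′ d → - - b ≡ (1ℤ * a + 0ℤ * c′) * 0ℤ + (1ℤ * b + 0ℤ * d) * 1ℤ - 0ℤ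
  e₁₂ = solve-∀
  e₂₁ : ∀ a b c′ d c → - - c′ ≡ (c * a + 1ℤ * c′) * 1ℤ + (c * b + 1ℤ * d) * c - c * (a + d + c * b)
  e₂₁ = solve-∀
  e₂₂ : ∀ a b c′ d c → - a ≡ (c * a + 1ℤ * c′) * 0ℤ + (c * b + 1ℤ * d) * 1ℤ - (a + d + c * b)
  e₂₂ = solve-∀

S≡[K,0,cK,K] : ∀ K → S K ≡ mat K 0ℤ ((+ 3 * K + + 3) * K) K
S≡[K,0,cK,K] K = cong (λ x → mat K 0ℤ x K) (polynomial K)
  where
  polynomial : ∀ K → + 3 * K * K + + 3 * K ≡ (+ 3 * K + + 3) * K
  polynomial = solve-∀

trace-neg-adj : ∀ c K M → tr M + c * a12 M ≡ K → tr (neg (adj M)) ≡ c * a12 (neg (adj M)) - K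
trace-neg-adj c ._ (mat a b c′ d) refl = polynomial a b d c
  where
  polynomial : ∀ a b d c → - d + - a ≡ c * - - b - (a + d + c * b)
  polynomial = solve-∀

a12-L⊗M⊗L⊖S : ∀ c K M → a12 (L c ⊗ M ⊗ L c ⊖ S K) ≡ a12 M
a12-L⊗M⊗L⊖S c K M = begin
  a12 (L c ⊗ M ⊗ L c ⊖ S K)   ≡⟨ +-identityʳ _ ⟩
  a12 (L c ⊗ M ⊗ L c)         ≡⟨ a12-⊗L c (L c ⊗ M) ⟩
  a12 (L c ⊗ M)               ≡⟨ a12-L⊗ c M ⟩
  a12 M                       ∎

tr-⊖S : ∀ N K → tr (N ⊖ S K) ≡ tr N - K - K
tr-⊖S (mat a b c d) K = polynomial a d K
  where
  polynomial : ∀ a d K → (a - K) + (d - K) ≡ (a + d) - K - K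
  polynomial = solve-∀

trace-L⊗M⊗L⊖S : ∀ c K M → tr (L c ⊗ M ⊗ L c ⊖ S K) ≡ c * a12 (L c ⊗ M ⊗ L c ⊖ S K) - K →
                tr M + c * a12 M ≡ K
trace-L⊗M⊗L⊖S c K M eq = cancel (tr M) (a12 M) (begin
  tr M + c * a12 M + c * a12 M - K - K
    ≡⟨ cong (λ t → t + c * a12 M - K - K) (tr-L⊗ c M) ⟨
  tr (L c ⊗ M) + c * a12 M - K - K
    ≡⟨ cong (λ x → tr (L c ⊗ M) + c * x - K - K) (a12-L⊗ c M) ⟨
  tr (L c ⊗ M) + c * a12 (L c ⊗ M) - K - K
    ≡⟨ cong (λ t → t - K - K) (tr-⊗L c (L c ⊗ M)) ⟨
  tr (L c ⊗ M ⊗ L c) - K - K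
    ≡⟨ tr-⊖S (L c ⊗ M ⊗ L c) K ⟨
  tr (L c ⊗ M ⊗ L c ⊖ S K)
    ≡⟨ eq ⟩
  c * a12 (L c ⊗ M ⊗ L c ⊖ S K) - K
    ≡⟨ cong (λ x → c * x - K) (a12-L⊗M⊗L⊖S c K M) ⟩
  c * a12 M - K ∎)
  where
  cancel : ∀ t m → t + c * m + c * m - K - K ≡ c * m - K → t + c * m ≡ K
  cancel t m h = begin
    t + c * m                                              ≡⟨ solve (t ∷ c ∷ m ∷ K ∷ []) ⟩
    (t + c * m + c * m - K - K) - (c * m - K) + K          ≡⟨ cong (λ u → u - (c * m - K) + K) h ⟩
    (c * m - K) - (c * m - K) + K                          ≡⟨ solve (c ∷ m ∷ K ∷ []) ⟩
    K                                                      ∎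

-- The Vieta involution of the k-GM equation

vieta : ℤ → ℤ → ℤ → ℤ → ℤ
vieta K a b c = (+ 3 * K + + 3) * a * c - K * (a + c) - b

gm-defect : ℤ → ℤ → ℤ → ℤ → ℤ
gm-defect K a b c = a * a + b * b + c * c + K * (b * c + c * a + a * b) - (+ 3 + + 3 * K) * a * b * c

vieta-involutive : ∀ K a b c → vieta K a (vieta K a b c) c ≡ b
vieta-involutive = polynomial
  where
  polynomial : ∀ K a b c →
    (+ 3 * K + + 3) * a * c - K * (a + c) - ((+ 3 * K + + 3) * a * c - K * (a + c) - b) ≡ b
  polynomial = solve-∀

vieta-from-sum : ∀ K x z m y →
  y + m ≡ (+ 3 * K + + 3) * x * z + - K * z + - K * x → y ≡ vieta K x m z
vieta-from-sum K x z m y eq = begin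
  y                                                   ≡⟨ solve (y ∷ m ∷ []) ⟩
  y + m - m                                           ≡⟨ cong (_- m) eq ⟩
  (+ 3 * K + + 3) * x * z + - K * z + - K * x - m     ≡⟨ solve (K ∷ x ∷ z ∷ m ∷ []) ⟩
  (+ 3 * K + + 3) * x * z - K * (x + z) - m           ∎

-- Viewed as a quadratic in its middle variable, the defect changes by
-- (b′ - b)(b + b′ - σ), where σ = (3K+3)ac - K(a+c) is the sum of its roots.
vieta-defect : ∀ K a b c → gm-defect K a (vieta K a b c) c ≡ gm-defect K a b c
vieta-defect K a b c = begin
  gm-defect K a b′ c                      ≡⟨ quadratic K a b c b′ ⟩
  gm-defect K a b c + (b′ - b) * (b + b′ - σ)
    ≡⟨ cong (λ v → gm-defect K a b c + (b′ - b) * v) (root-sum K a b c) ⟩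
  gm-defect K a b c + (b′ - b) * 0ℤ       ≡⟨ cong (λ x → gm-defect K a b c + x) (*-zeroʳ (b′ - b)) ⟩
  gm-defect K a b c + 0ℤ                  ≡⟨ +-identityʳ _ ⟩
  gm-defect K a b c                       ∎
  where
  b′ σ : ℤ
  b′ = vieta K a b c
  σ  = (+ 3 * K + + 3) * a * c - K * (a + c)
  quadratic : ∀ K a b c b′ →
    a * a + b′ * b′ + c * c + K * (b′ * c + c * a + a * b′) - (+ 3 + + 3 * K) * a * b′ * c
    ≡ a * a + b * b + c * c + K * (b * c + c * a + a * b) - (+ 3 + + 3 * K) * a * b * c
      + (b′ - b) * (b + b′ - ((+ 3 * K + + 3) * a * c - K * (a + c)))
  quadratic = solve-∀
  root-sum : ∀ K a b c →
    b + ((+ 3 * K + + 3) * a * c - K * (a + c) - b) - ((+ 3 * K + + 3) * a * c - K * (a + c)) ≡ 0ℤ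
  root-sum = solve-∀

vieta-product : ∀ K a b c → b * vieta K a b c ≡ a * a + c * c + K * c * a - gm-defect K a b c
vieta-product = polynomial
  where
  polynomial : ∀ K a b c →
    b * ((+ 3 * K + + 3) * a * c - K * (a + c) - b)
    ≡ a * a + c * c + K * c * a
      - (a * a + b * b + c * c + K * (b * c + c * a + a * b) - (+ 3 + + 3 * K) * a * b * c)
  polynomial = solve-∀

vieta-numerator-positive : ∀ k {a c} → 0ℤ < a → 0ℤ < c → 0ℤ < a * a + c * c + + k * c * a
vieta-numerator-positive k {+[1+ m ]} {+[1+ n ]} _ _ =
  +-mono-<-≤ (+-mono-<-≤ a*a>0 c*c≥0) k*c*a≥0
  where
  a*a>0 : 0ℤ < +[1+ m ] * +[1+ m ]
  a*a>0 = +<+ (s≤s z≤n)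
  c*c≥0 : 0ℤ ≤ +[1+ n ] * +[1+ n ]
  c*c≥0 = +≤+ z≤n
  k*c*a≥0 : 0ℤ ≤ + k * +[1+ n ] * +[1+ m ]
  k*c*a≥0 = subst (0ℤ ≤_)
    (trans (pos-* (k ℕ.* suc n) (suc m)) (cong (_* +[1+ m ]) (pos-* k (suc n))))
    (+≤+ z≤n)
vieta-numerator-positive k {+0}      (+<+ ()) _
vieta-numerator-positive k { -[1+ _ ]} () _
vieta-numerator-positive k {+[1+ m ]} {+0}      _ (+<+ ())
vieta-numerator-positive k {+[1+ m ]} { -[1+ _ ]} _ ()

GMTriple-vieta : ∀ k {a b c} → GMTriple k a b c → GMTriple k a (vieta (+ k) a b c) c
GMTriple-vieta k {a} {b} {c} (0<a , 0<b , 0<c , eq) = 0<a , 0<b′ , 0<c , eq′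
  where
  b′ : ℤ
  b′ = vieta (+ k) a b c
  defect≡0 : gm-defect (+ k) a b c ≡ 0ℤ
  defect≡0 = i≡j⇒i-j≡0 eq
  eq′ : a * a + b′ * b′ + c * c + + k * (b′ * c + c * a + a * b′) ≡ (+ 3 + + 3 * + k) * a * b′ * c
  eq′ = i-j≡0⇒i≡j _ _ (trans (vieta-defect (+ k) a b c) defect≡0)
  product : b * b′ ≡ a * a + c * c + + k * c * a
  product = trans (vieta-product (+ k) a b c)
                  (trans (cong (λ x → a * a + c * c + + k * c * a - x) defect≡0) (+-identityʳ _))
  0<b′ : 0ℤ < b′
  0<b′ = *-cancelˡ-<-nonNeg b {{nonNegative (<⇒≤ 0<b)}}
    (subst₂ _<_ (sym (*-zeroʳ b)) (sym product) (vieta-numerator-positive k 0<a 0<c))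

GMTriple-resp : ∀ k {a b c a′ b′ c′} → a ≡ a′ → b ≡ b′ → c ≡ c′ →
                GMTriple k a b c → GMTriple k a′ b′ c′
GMTriple-resp k refl refl refl g = g

module _ (k : ℕ) {a b c : ℤ} (g : GMTriple k a b c) where

  GMTriple⇒GMNumber₁ : GMNumber k a
  GMTriple⇒GMNumber₁ = b , c , inj₁ g

  GMTriple⇒GMNumber₂ : GMNumber k b
  GMTriple⇒GMNumber₂ = a , c , inj₂ (inj₁ g)

  GMTriple⇒GMNumber₃ : GMNumber k c
  GMTriple⇒GMNumber₃ = a , b , inj₂ (inj₂ g)

-- MM and GC triples through their outer pair

module _ (k : ℕ) where

  private
    K C : ℤ
    K = + k
    C = κ k
    Lₖ : Mat
    Lₖ = L C

  middle : Mat → Mat → Mat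
  middle X Z = adj X ⊗ Tmat k ⊗ adj Z

  record OuterPair (X Z : Mat) : Set where
    field
      det-X : InSL2 X
      det-Z : InSL2 Z
      tr-X  : tr X ≡ - K
      tr-Z  : tr Z ≡ - K
      tr-XZ : tr (X ⊗ Z) + C * a12 (X ⊗ Z) ≡ K
      gm    : GMTriple k (a12 X) (a12 (X ⊗ Z)) (a12 Z)

  neg-adj≡L⊗M⊗L⊖S : ∀ M → tr M + C * a12 M ≡ K → neg (adj M) ≡ Lₖ ⊗ M ⊗ Lₖ ⊖ Smat k
  neg-adj≡L⊗M⊗L⊖S M eq =
    trans (neg-adj≡L⊗M⊗L⊖[K,0,cK,K] C K M eq) (cong (Lₖ ⊗ M ⊗ Lₖ ⊖_) (sym (S≡[K,0,cK,K] K)))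

  a12-middle-vieta : ∀ X Z → tr X ≡ - K → tr Z ≡ - K →
                     a12 (middle X Z) ≡ vieta K (a12 X) (a12 (X ⊗ Z)) (a12 Z)
  a12-middle-vieta X Z trX trZ = vieta-from-sum K (a12 X) (a12 Z) (a12 (X ⊗ Z)) (a12 (middle X Z)) (begin
    a12 (middle X Z) + a12 (X ⊗ Z)                     ≡⟨ a12-middle C X Z ⟩
    C * a12 X * a12 Z + tr X * a12 Z + tr Z * a12 X
      ≡⟨ cong₂ (λ s t → C * a12 X * a12 Z + s * a12 Z + t * a12 X) trX trZ ⟩
    C * a12 X * a12 Z + - K * a12 Z + - K * a12 X      ∎)

  Φ-middle : ∀ X Z → InSL2 X → InSL2 Z →
             Φ (X , middle X Z , Z) ≡ (Lₖ ⊗ X , neg (inv (X ⊗ Z)) , Z ⊗ Lₖ)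
  Φ-middle X Z detX detZ = cong₂ _,_ P≡ (cong (neg (inv (X ⊗ Z)) ,_) R≡)
    where
    P≡ : neg (inv (middle X Z ⊗ Z)) ≡ Lₖ ⊗ X
    P≡ = trans (cong (neg ∘′ inv) (B⊗adjA⊗A≡B Z detZ (adj X ⊗ Tmat k))) (neg-inv[adjA⊗T] C X detX)
    R≡ : neg (inv (X ⊗ middle X Z)) ≡ Z ⊗ Lₖ
    R≡ = trans (cong (neg ∘′ inv) (X⊗middle≡B⊗adjZ X Z detX detZ (Tmat k))) (neg-inv[T⊗adjA] C Z detZ)

  MMTriple⇒middle : ∀ X Y Z → MMTriple k (X , Y , Z) → Y ≡ middle X Z
  MMTriple⇒middle X Y Z ((detX , _) , _ , (detZ , _) , XYZ≡T , _) = middle-unique X Z detX detZ XYZ≡T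

  Φ-MMTriple : ∀ X Y Z → MMTriple k (X , Y , Z) → Φ (X , Y , Z) ≡ (Lₖ ⊗ X , neg (inv (X ⊗ Z)) , Z ⊗ Lₖ)
  Φ-MMTriple X Y Z mm@((detX , _) , _ , (detZ , _) , _) =
    trans (cong (λ Y → Φ (X , Y , Z)) (MMTriple⇒middle X Y Z mm)) (Φ-middle X Z detX detZ)

  MMTriple⇒OuterPair : ∀ X Y Z → MMTriple k (X , Y , Z) → OuterPair X Z
  MMTriple⇒OuterPair X Y Z mm@((detX , _ , trX) , (_ , _ , trY) , (detZ , _ , trZ) , _ , gmY) =
    record { det-X = detX ; det-Z = detZ ; tr-X = trX ; tr-Z = trZ ; tr-XZ = tr-XZ ; gm = gmM }
    where
    Y≡ : Y ≡ middle X Z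
    Y≡ = MMTriple⇒middle X Y Z mm
    tr-XZ : tr (X ⊗ Z) + C * a12 (X ⊗ Z) ≡ K
    tr-XZ = neg-injective (begin
      - (tr (X ⊗ Z) + C * a12 (X ⊗ Z))   ≡⟨ tr-middle C X Z ⟨
      tr (middle X Z)                     ≡⟨ cong tr Y≡ ⟨
      tr Y                                ≡⟨ trY ⟩
      - K                                 ∎)
    m≡vieta : a12 (X ⊗ Z) ≡ vieta K (a12 X) (a12 Y) (a12 Z)
    m≡vieta = begin
      a12 (X ⊗ Z)                                   ≡⟨ vieta-involutive K (a12 X) (a12 (X ⊗ Z)) (a12 Z) ⟨
      vieta K (a12 X) (vieta K (a12 X) (a12 (X ⊗ Z)) (a12 Z)) (a12 Z)
        ≡⟨ cong (λ y → vieta K (a12 X) y (a12 Z)) (a12-middle-vieta X Z trX trZ) ⟨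
      vieta K (a12 X) (a12 (middle X Z)) (a12 Z)    ≡⟨ cong (λ Y → vieta K (a12 X) (a12 Y) (a12 Z)) Y≡ ⟨
      vieta K (a12 X) (a12 Y) (a12 Z)               ∎
    gmM : GMTriple k (a12 X) (a12 (X ⊗ Z)) (a12 Z)
    gmM = GMTriple-resp k refl (sym m≡vieta) refl (GMTriple-vieta k gmY)

  OuterPair⇒MMTriple : ∀ {X Z} → OuterPair X Z → MMTriple k (X , middle X Z , Z)
  OuterPair⇒MMTriple {X} {Z} o =
    (det-X , GMTriple⇒GMNumber₁ k gmY , tr-X) ,
    (detY , GMTriple⇒GMNumber₂ k gmY , trY) ,
    (det-Z , GMTriple⇒GMNumber₃ k gmY , tr-Z) ,
    middle-spec X Z det-X det-Z (Tmat k) , gmY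
    where
    open OuterPair o
    detY : InSL2 (middle X Z)
    detY = SL-⊗ (adj X ⊗ Tmat k) (adj Z) (SL-⊗ (adj X) (Tmat k) (SL-adj X det-X) (det-T C)) (SL-adj Z det-Z)
    trY : tr (middle X Z) ≡ - K
    trY = trans (tr-middle C X Z) (cong -_ tr-XZ)
    gmY : GMTriple k (a12 X) (a12 (middle X Z)) (a12 Z)
    gmY = GMTriple-resp k refl (sym (a12-middle-vieta X Z tr-X tr-Z)) refl (GMTriple-vieta k gm)

  L⊗X⊗[Z⊗L]≡L⊗[X⊗Z]⊗L : ∀ X Z → Lₖ ⊗ X ⊗ (Z ⊗ Lₖ) ≡ Lₖ ⊗ (X ⊗ Z) ⊗ Lₖ
  L⊗X⊗[Z⊗L]≡L⊗[X⊗Z]⊗L X Z = begin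
    Lₖ ⊗ X ⊗ (Z ⊗ Lₖ)      ≡⟨ ⊗-assoc (Lₖ ⊗ X) Z Lₖ ⟨
    Lₖ ⊗ X ⊗ Z ⊗ Lₖ        ≡⟨ cong (_⊗ Lₖ) (⊗-assoc Lₖ X Z) ⟩
    Lₖ ⊗ (X ⊗ Z) ⊗ Lₖ      ∎

  OuterPair⇒GCTriple : ∀ {X Z} → OuterPair X Z →
                       GCTriple k (Lₖ ⊗ X , neg (inv (X ⊗ Z)) , Z ⊗ Lₖ)
  OuterPair⇒GCTriple {X} {Z} o =
    (SL-⊗ Lₖ X (det-L C) det-X , GMTriple⇒GMNumber₁ k gmPQR , Equivalence.to (trace-L⊗ C K X) tr-X) ,
    (detQ , GMTriple⇒GMNumber₂ k gmPQR , trQ) ,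
    (SL-⊗ Z Lₖ det-Z (det-L C) , GMTriple⇒GMNumber₃ k gmPQR , Equivalence.to (trace-⊗L C K Z) tr-Z) ,
    Q≡PR-S , gmPQR
    where
    open OuterPair o
    M : Mat
    M = X ⊗ Z
    detM : InSL2 M
    detM = SL-⊗ X Z det-X det-Z
    Q≡ : neg (inv M) ≡ neg (adj M)
    Q≡ = cong neg (inv≡adj M detM)
    detQ : InSL2 (neg (inv M))
    detQ = trans (cong det Q≡) (trans (det-neg (adj M)) (SL-adj M detM))
    trQ : tr (neg (inv M)) ≡ C * a12 (neg (inv M)) - K
    trQ = subst (λ Q → tr Q ≡ C * a12 Q - K) (sym Q≡) (trace-neg-adj C K M tr-XZ)
    Q≡PR-S : neg (inv M) ≡ Lₖ ⊗ X ⊗ (Z ⊗ Lₖ) ⊖ Smat k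
    Q≡PR-S = begin
      neg (inv M)                  ≡⟨ Q≡ ⟩
      neg (adj M)                  ≡⟨ neg-adj≡L⊗M⊗L⊖S M tr-XZ ⟩
      Lₖ ⊗ M ⊗ Lₖ ⊖ Smat k         ≡⟨ cong (_⊖ Smat k) (L⊗X⊗[Z⊗L]≡L⊗[X⊗Z]⊗L X Z) ⟨
      Lₖ ⊗ X ⊗ (Z ⊗ Lₖ) ⊖ Smat k   ∎
    gmPQR : GMTriple k (a12 (Lₖ ⊗ X)) (a12 (neg (inv M))) (a12 (Z ⊗ Lₖ))
    gmPQR = GMTriple-resp k (sym (a12-L⊗ C X)) (sym (trans (cong a12 Q≡) (a12-neg-adj M)))
                          (sym (a12-⊗L C Z)) gm

  GCTriple⇒OuterPair : ∀ P Q R → GCTriple k (P , Q , R) →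
    let X = adj Lₖ ⊗ P ; Z = R ⊗ adj Lₖ in OuterPair X Z × Q ≡ neg (inv (X ⊗ Z))
  GCTriple⇒OuterPair P Q R ((detP , _ , trP) , (_ , _ , trQ) , (detR , _ , trR) , Q≡PR-S , gmPQR) =
    record { det-X = detX ; det-Z = detZ ; tr-X = trX ; tr-Z = trZ ; tr-XZ = tr-XZ ; gm = gmM } ,
    Q≡-M⁻¹
    where
    X Z M : Mat
    X = adj Lₖ ⊗ P
    Z = R ⊗ adj Lₖ
    M = X ⊗ Z
    L⊗X≡P : Lₖ ⊗ X ≡ P
    L⊗X≡P = A⊗[adjA⊗B]≡B Lₖ (det-L C) P
    Z⊗L≡R : Z ⊗ Lₖ ≡ R
    Z⊗L≡R = B⊗adjA⊗A≡B Lₖ (det-L C) R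
    detX : InSL2 X
    detX = SL-⊗ (adj Lₖ) P (SL-adj Lₖ (det-L C)) detP
    detZ : InSL2 Z
    detZ = SL-⊗ R (adj Lₖ) detR (SL-adj Lₖ (det-L C))
    trX : tr X ≡ - K
    trX = Equivalence.from (trace-L⊗ C K X) (subst (λ P → tr P ≡ C * a12 P - K) (sym L⊗X≡P) trP)
    trZ : tr Z ≡ - K
    trZ = Equivalence.from (trace-⊗L C K Z) (subst (λ R → tr R ≡ C * a12 R - K) (sym Z⊗L≡R) trR)
    Q≡LML-S : Q ≡ Lₖ ⊗ M ⊗ Lₖ ⊖ Smat k
    Q≡LML-S = begin
      Q                           ≡⟨ Q≡PR-S ⟩
      P ⊗ R ⊖ Smat k              ≡⟨ cong₂ (λ P R → P ⊗ R ⊖ Smat k) L⊗X≡P Z⊗L≡R ⟨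
      Lₖ ⊗ X ⊗ (Z ⊗ Lₖ) ⊖ Smat k  ≡⟨ cong (_⊖ Smat k) (L⊗X⊗[Z⊗L]≡L⊗[X⊗Z]⊗L X Z) ⟩
      Lₖ ⊗ M ⊗ Lₖ ⊖ Smat k        ∎
    tr-XZ : tr M + C * a12 M ≡ K
    tr-XZ = trace-L⊗M⊗L⊖S C K M (subst (λ Q → tr Q ≡ C * a12 Q - K) Q≡LML-S trQ)
    Q≡-M⁻¹ : Q ≡ neg (inv M)
    Q≡-M⁻¹ = begin
      Q                      ≡⟨ Q≡LML-S ⟩
      Lₖ ⊗ M ⊗ Lₖ ⊖ Smat k   ≡⟨ neg-adj≡L⊗M⊗L⊖S M tr-XZ ⟨
      neg (adj M)            ≡⟨ cong neg (inv≡adj M (SL-⊗ X Z detX detZ)) ⟨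
      neg (inv M)            ∎
    gmM : GMTriple k (a12 X) (a12 M) (a12 Z)
    gmM = GMTriple-resp k (sym (a12-L⊗ (- C) P)) (trans (cong a12 Q≡LML-S) (a12-L⊗M⊗L⊖S C K M))
                          (sym (a12-⊗L (- C) R)) gmPQR

  Φ-maps-MM-to-GC : (t : Triple Mat) → MMTriple k t → GCTriple k (Φ t)
  Φ-maps-MM-to-GC (X , Y , Z) mm =
    subst (GCTriple k) (sym (Φ-MMTriple X Y Z mm)) (OuterPair⇒GCTriple (MMTriple⇒OuterPair X Y Z mm))

  Φ-injective-on-MM : (t u : Triple Mat) → MMTriple k t → MMTriple k u → Φ t ≡ Φ u → t ≡ u
  Φ-injective-on-MM (X , Y , Z) (X′ , Y′ , Z′) mm mm′ Φt≡Φu = cong₂ _,_ X≡X′ (cong₂ _,_ Y≡Y′ Z≡Z′)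
    where
    images≡ : (Lₖ ⊗ X , neg (inv (X ⊗ Z)) , Z ⊗ Lₖ) ≡ (Lₖ ⊗ X′ , neg (inv (X′ ⊗ Z′)) , Z′ ⊗ Lₖ)
    images≡ = trans (sym (Φ-MMTriple X Y Z mm)) (trans Φt≡Φu (Φ-MMTriple X′ Y′ Z′ mm′))
    X≡X′ : X ≡ X′
    X≡X′ = SL-cancelˡ Lₖ (det-L C) (cong proj₁ images≡)
    Z≡Z′ : Z ≡ Z′
    Z≡Z′ = SL-cancelʳ Lₖ (det-L C) (cong (proj₂ ∘′ proj₂) images≡)
    Y≡Y′ : Y ≡ Y′
    Y≡Y′ = begin
      Y              ≡⟨ MMTriple⇒middle X Y Z mm ⟩
      middle X Z     ≡⟨ cong₂ middle X≡X′ Z≡Z′ ⟩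
      middle X′ Z′   ≡⟨ MMTriple⇒middle X′ Y′ Z′ mm′ ⟨
      Y′             ∎

  Φ-onto-GC : (s : Triple Mat) → GCTriple k s → ∃[ t ] (MMTriple k t × Φ t ≡ s)
  Φ-onto-GC (P , Q , R) gc = (X , middle X Z , Z) , OuterPair⇒MMTriple o , Φt≡PQR
    where
    X Z : Mat
    X = adj Lₖ ⊗ P
    Z = R ⊗ adj Lₖ
    o : OuterPair X Z
    o = proj₁ (GCTriple⇒OuterPair P Q R gc)
    Φt≡PQR : Φ (X , middle X Z , Z) ≡ (P , Q , R)
    Φt≡PQR = begin
      Φ (X , middle X Z , Z)                  ≡⟨ Φ-middle X Z (OuterPair.det-X o) (OuterPair.det-Z o) ⟩
      (Lₖ ⊗ X , neg (inv (X ⊗ Z)) , Z ⊗ Lₖ)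
        ≡⟨ cong₂ _,_ (A⊗[adjA⊗B]≡B Lₖ (det-L C) P)
                     (cong₂ _,_ (sym (proj₂ (GCTriple⇒OuterPair P Q R gc))) (B⊗adjA⊗A≡B Lₖ (det-L C) R)) ⟩
      (P , Q , R)                             ∎

corollary5p30 : (k : ℕ) →
    -- Φ maps k-MM triples to k-GC triples
    ((t : Triple Mat) → MMTriple k t → GCTriple k (Φ t)) ×
    -- injective on k-MM triples
    ((t u : Triple Mat) → MMTriple k t → MMTriple k u → Φ t ≡ Φ u → t ≡ u) ×
    -- onto the k-GC triples
    ((s : Triple Mat) → GCTriple k s → ∃[ t ] (MMTriple k t × Φ t ≡ s))
corollary5p30 k = Φ-maps-MM-to-GC k , Φ-injective-on-MM k , Φ-onto-GC k
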